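{- Let $n$ be a power of $2$ and let $T$ be a rooted tree with at most $n$ nodes. There exists a legal interval-mapping of $T$ into $\mathcal{I}_{\log n}([1,4n\log n])$, i.e., a one-to-one map $I:V(T)\to\mathcal{I}_{\log n}([1,4n\log n])$ such that every node of $T$ satisfies the local partial order conditions (LPO1) and (LPO2).
   Context: Logarithms are base $2$. For integers $a\le b$, the interval $[a,b]$ is the set of integers $\{a,\dots,b\}$; for intervals $I=[a,b]$, $I'=[a',b']$ we write $I\prec I'$ if $b<a'$. For integers $i,a,b$ let $I_{i,a,b}=[2^i a,\,2^i(a+b)]$. For $k\in[1,\log n]$ let $\mathcal{I}_k=\{I_{i,a,b} : i\in[1,k],\ a\in[1,4n\log n/2^i],\ b\in[1,4\log n]\}$ (integer parameters), and for an interval $J$ let $\mathcal{I}_k(J)=\{I_{i,a,b}\in\mathcal{I}_k : I_{i,a,b}\subseteq J\}$. In a rooted tree with root $r$, $u$ is an ancestor of $v$ if $u\ne v$ and $u$ lies on the path from $v$ to $r$; $\operatorname{parent}(u)$ is the ancestor at distance $1$. The weight of a node is the number of nodes in its subtree (including itself). For each non-leaf node, among its children of maximum weight exactly one is chosen and called heavy; all other nodes, including the root, are light. The supervisor $\operatorname{sp}(u)$ is the light node of largest depth on the path from $u$ to the root. Nodes are numbered by $\mathrm{DFS}(u)$ according to a depth-first traversal from the root visiting light children before the heavy child. For a non-root node $u$, with $P_u$ the path from $\operatorname{parent}(u)$ to $\operatorname{sp}(\operatorname{parent}(u))$ (inclusive), $\operatorname{lqa}(u)$ is the set of nodes of $P_u$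 together with their light children, excluding $u$, $\operatorname{sp}(\operatorname{parent}(u))$, and all nodes $x$ with $\mathrm{DFS}(x)>\mathrm{DFS}(u)$; $\operatorname{lqa}(r)=\emptyset$. Given intervals $I(u)$ for the nodes, node $u$ satisfies (LPO1) if, when $u\ne r$, $I(u)\subseteq I(\operatorname{sp}(u))\cap I(\operatorname{sp}(\operatorname{parent}(u)))$, and (LPO2) if $I(x)\prec I(u)$ for all $x\in\operatorname{lqa}(u)$. -}

module Defs where

open import Data.Nat using (ℕ; zero; suc; _+_; _*_; _^_; _≤_; _<_)
open import Data.Fin using (Fin; toℕ)
open import Data.Fin.Properties using (_≟_)
open import Data.Bool using (Bool; true; false; if_then_else_)
open import Data.List using (List; map; upTo; allFin)
open import Data.Bool.ListAction using (any)
open import Data.Nat.ListAction using (sum)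
open import Data.Product using (Σ; ∃; ∃-syntax; _×_; _,_; proj₁; proj₂)
open import Data.Sum using (_⊎_)
open import Relation.Nullary using (¬_)
open import Relation.Nullary.Decidable using (⌊_⌋)
open import Relation.Binary.PropositionalEquality using (_≡_; _≢_)

iter : {A : Set} → (A → A) → ℕ → A → A
iter f zero    x = x
iter f (suc k) x = f (iter f k x)

-- The root is its own "parent" (a convention; parent(root) is never used
-- as a real node), and every node reaches the root by iterating parent.

record RootedTree (m : ℕ) : Set where
  field
    root     : Fin m
    par      : Fin m → Fin m
    par-root : par root ≡ root
    reach    : ∀ v → ∃[ k ] iter par k v ≡ root

module _ {m : ℕ} (T : RootedTree m) where
  open RootedTree T

  Child : Fin m → Fin m → Set
  Child x y = x ≢ root × par x ≡ y

  InSubtree : Fin m → Fin m → Set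
  InSubtree u w = ∃[ k ] iter par k w ≡ u

  -- decidable version: paths to the root have fewer than m edges
  inSubtree? : Fin m → Fin m → Bool
  inSubtree? u w = any (λ k → ⌊ iter par k w ≟ u ⌋) (upTo m)

  weight : Fin m → ℕ
  weight u = sum (map (λ w → if inSubtree? u w then 1 else 0) (allFin m))

  record HeavyChoice (heavy : Fin m → Bool) : Set where
    field
      root-light  : heavy root ≡ false
      heavy-child : ∀ x → heavy x ≡ true → x ≢ root
      one-heavy   : ∀ y x → Child x y →
                    Σ (Fin m) λ h → Child h y × heavy h ≡ true
                      × (∀ c → Child c y → weight c ≤ weight h)
                      × (∀ c → Child c y → heavy c ≡ true → c ≡ h)

  module _ (heavy : Fin m → Bool) where

    Light : Fin m → Set
    Light x = heavy x ≡ false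

    IsSp : Fin m → Fin m → Set
    IsSp u s = ∃[ k ] iter par k u ≡ s × Light s
                 × (∀ j → j < k → heavy (iter par j u) ≡ true)

    -- A numbering is a
    -- DFS preorder exactly when it is injective and every subtree occupies
    -- the contiguous block of numbers starting at its root.
    record IsDFS (dfs : Fin m → Fin m) : Set where
      field
        injective  : ∀ u v → dfs u ≡ dfs v → u ≡ v
        contiguous : ∀ u w → (InSubtree u w →
                                toℕ (dfs u) ≤ toℕ (dfs w) × toℕ (dfs w) < toℕ (dfs u) + weight u)
                           × (toℕ (dfs u) ≤ toℕ (dfs w) → toℕ (dfs w) < toℕ (dfs u) + weight u →
                                InSubtree u w)
        light-first : ∀ x h y → Child x y → Child h y → Light x → heavy h ≡ true →
                      toℕ (dfs x) < toℕ (dfs h)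

    OnPath : Fin m → Fin m → Fin m → Set
    OnPath v s x = ∃[ k ] iter par k v ≡ x × (∀ l → l < k → iter par l v ≢ s)

    InLqa : (Fin m → Fin m) → Fin m → Fin m → Set
    InLqa dfs u x =
      u ≢ root × Σ (Fin m) λ s → IsSp (par u) s
        × (OnPath (par u) s x ⊎ (Light x × x ≢ root × OnPath (par u) s (par x)))
        × x ≢ u × x ≢ s × toℕ (dfs x) ≤ toℕ (dfs u)

-- Intervals [l, r] of integers (l ≤ r) represented by their endpoints (l , r).

Interval : Set
Interval = ℕ × ℕ

_⊆I_ : Interval → Interval → Set
(a , b) ⊆I (c , d) = c ≤ a × b ≤ d

_≺_ : Interval → Interval → Set
(a , b) ≺ (c , d) = b < c

I[_,_,_] : ℕ → ℕ → ℕ → Interval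
I[ i , a , b ] = (2 ^ i * a , 2 ^ i * (a + b))

-- J ∈ 𝓘_k with respect to n and log n = p:
-- i ∈ [1,k], a ∈ [1, 4 n log n / 2^i], b ∈ [1, 4 log n]
-- (a ≤ 4 n p / 2^i is written a * 2^i ≤ 4 n p, equivalent over ℕ)
In𝓘 : (n p k : ℕ) → Interval → Set
In𝓘 n p k J = Σ ℕ λ i → Σ ℕ λ a → Σ ℕ λ b →
  (1 ≤ i × i ≤ k) × (1 ≤ a × a * 2 ^ i ≤ 4 * n * p) × (1 ≤ b × b ≤ 4 * p)
  × J ≡ I[ i , a , b ]

In𝓘⊆ : (n p k : ℕ) → Interval → Interval → Set
In𝓘⊆ n p k K J = In𝓘 n p k J × J ⊆I K

module _ {m : ℕ} (T : RootedTree m) (heavy : Fin m → Bool)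
         (dfs : Fin m → Fin m) (I : Fin m → Interval) where
  open RootedTree T

  LPO1 : Fin m → Set
  LPO1 u = u ≢ root → ∀ s s' → IsSp T heavy u s → IsSp T heavy (par u) s' →
           (I u ⊆I I s) × (I u ⊆I I s')

  LPO2 : Fin m → Set
  LPO2 u = ∀ x → InLqa T heavy dfs u x → I x ≺ I u

module Submission where

-- Lay the tree out on a line along the DFS walk (light children first):
-- a node pays an opening cost when the walk enters it and a closing cost
-- when the walk leaves its subtree; a heavy node opens for 4 and closes
-- for free, a light node of weight w pays 2 ^ level w for each, where
-- level w is the least ℓ ≥ 1 with w ≤ 2 ^ ℓ.  With pos u the amount paid
-- before u is entered and span u the total paid by the subtree of u, the
-- interval of u starts at the first multiple of 2 ^ lvl u above pos u; a
-- heavy node takes one grid step, a light node extends to the last grid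
-- point not above pos u + span u.  Subtrees become nested blocks of the
-- line and DFS order becomes precedence, which gives (LPO1), (LPO2) and
-- injectivity.  For the size, a charging argument (weights double at light
-- nodes, so every node has few light ancestors) bounds span y by
-- 4 ℓ 2 ^ ℓ for a light y with ℓ = level (W y); hence everything fits
-- into [1, 4 n p] and lengths are below 4 p grid steps.

open import Defs
open import Data.Nat using (ℕ; _*_; _^_; _≤_)
open import Data.Fin using (Fin)
open import Data.Bool using (Bool)
open import Data.Product using (Σ; _×_; _,_)
open import Relation.Binary.PropositionalEquality using (_≡_)

open import Data.Nat using (zero; suc; _+_; _∸_; _<_; _⊔_; _⊓_; z≤n; s≤s; s≤s⁻¹; _≤?_; _<?_; NonZero; >-nonZero; pred)
open import Data.Nat.Properties hiding (_≟_)
import Data.Nat.Properties as ℕ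
open import Data.Nat.DivMod using (_/_; _%_; m≡m%n+[m/n]*n; m%n<n; m/n*n≤m; m*n/n≡m; /-monoˡ-≤)
open import Data.Nat.Solver using (module +-*-Solver)
open import Data.Fin using (toℕ; fromℕ<; punchOut) renaming (zero to fzero; suc to fsuc)
open import Data.Fin.Properties using (_≟_; toℕ-injective; toℕ<n; toℕ-fromℕ<; punchOut-injective; injective⇒≤; any?)
  renaming (suc-injective to fsuc-injective)
open import Data.Bool using (true; false; if_then_else_) renaming (T to Holds)
open import Data.List using (tabulate; allFin; map; upTo)
import Data.List.Properties as List
import Data.Nat.ListAction as List
open import Data.List.Membership.Propositional using (lose)
open import Data.List.Membership.Propositional.Properties using (∈-upTo⁺)
open import Data.List.Relation.Unary.Any using (satisfied)
open import Data.List.Relation.Unary.Any.Properties using (any⁺; any⁻)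
open import Data.Product using (∃; proj₁; proj₂; uncurry)
open import Data.Sum using (_⊎_; inj₁; inj₂)
open import Data.Empty using (⊥; ⊥-elim)
open import Data.Unit using (tt)
open import Relation.Nullary using (¬_; Dec; yes; no; contradiction)
open import Relation.Nullary.Decidable using (map′; _×-dec_; _⊎-dec_; ¬?; toWitness; fromWitness)
open import Relation.Binary using (tri<; tri≈; tri>)
open import Relation.Binary.PropositionalEquality using (_≢_; refl; sym; trans; cong; cong₂; subst; subst₂; module ≡-Reasoning)
open import Function using (_∘_; id)
open import Algebra.Properties.CommutativeMonoid.Sum +-0-commutativeMonoid
  using (sum; sum-syntax; sum-cong-≗; ∑-distrib-+; ∑-comm)

when : {P : Set} → Dec P → ℕ → ℕ
when (yes _) a = a
when (no _)  _ = 0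

module _ {P : Set} where

  when-yes : (d : Dec P) → P → ∀ a → when d a ≡ a
  when-yes (yes _) _ _ = refl
  when-yes (no ¬p) p _ = contradiction p ¬p

  when-no : (d : Dec P) → ¬ P → ∀ a → when d a ≡ 0
  when-no (yes p) ¬p _ = contradiction p ¬p
  when-no (no _)  _  _ = refl

  when-≤ : (d : Dec P) → ∀ a → when d a ≤ a
  when-≤ (yes _) _ = ≤-refl
  when-≤ (no _)  _ = z≤n

  when-mono : (d : Dec P) → ∀ {a b} → a ≤ b → when d a ≤ when d b
  when-mono (yes _) a≤b = a≤b
  when-mono (no _)  _   = z≤n

  when-* : (d : Dec P) → ∀ k a → when d (k * a) ≡ k * when d a
  when-* (yes _) _ _ = refl
  when-* (no _)  k _ = sym (*-zeroʳ k)

  when-0 : (d : Dec P) → when d 0 ≡ 0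
  when-0 (yes _) = refl
  when-0 (no _)  = refl

when-imp : {P Q : Set} (dp : Dec P) (dq : Dec Q) → (P → Q) → ∀ a → when dp a ≤ when dq a
when-imp (yes p) dq p⇒q a = ≤-reflexive (sym (when-yes dq (p⇒q p) a))
when-imp (no _)  _  _   _ = z≤n

when-disjoint : {A B C : Set} (dA : Dec A) (dB : Dec B) (dC : Dec C) →
                (A → C) → (B → C) → (A → B → ⊥) → ∀ a → when dA a + when dB a ≤ when dC a
when-disjoint (yes a) (yes b) _  _   _   disj _ = contradiction b (disj a)
when-disjoint (yes a) (no _)  dC A⇒C _   _    x =
  ≤-reflexive (trans (+-identityʳ x) (sym (when-yes dC (A⇒C a) x)))
when-disjoint (no _)  dB      dC _   B⇒C _    x = when-imp dB dC B⇒C x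

when-⇔ : {P Q : Set} (dp : Dec P) (dq : Dec Q) → (P → Q) → (Q → P) → ∀ a → when dp a ≡ when dq a
when-⇔ dp dq P⇒Q Q⇒P a = ≤-antisym (when-imp dp dq P⇒Q a) (when-imp dq dp Q⇒P a)

∑-mono : ∀ {m} {f g : Fin m → ℕ} → (∀ x → f x ≤ g x) → sum f ≤ sum g
∑-mono {m = zero}  f≤g = z≤n
∑-mono {m = suc m} f≤g = +-mono-≤ (f≤g fzero) (∑-mono (f≤g ∘ fsuc))

∑-zero : ∀ {m} (f : Fin m → ℕ) → (∀ x → f x ≡ 0) → sum f ≡ 0
∑-zero {m = zero}  f f≡0 = refl
∑-zero {m = suc m} f f≡0 rewrite f≡0 fzero = ∑-zero (f ∘ fsuc) (f≡0 ∘ fsuc)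

∑-*ˡ : ∀ {m} k (f : Fin m → ℕ) → ∑[ x < m ] (k * f x) ≡ k * sum f
∑-*ˡ {m = zero}  k f = sym (*-zeroʳ k)
∑-*ˡ {m = suc m} k f =
  trans (cong (k * f fzero +_) (∑-*ˡ k (f ∘ fsuc))) (sym (*-distribˡ-+ k (f fzero) _))

∑-single : ∀ {m} (f : Fin m → ℕ) (u : Fin m) → (∀ x → x ≢ u → f x ≡ 0) → sum f ≡ f u
∑-single {m = suc m} f fzero f≡0 =
  trans (cong (f fzero +_) (∑-zero (f ∘ fsuc) (λ x → f≡0 (fsuc x) λ ())))
        (+-identityʳ _)
∑-single {m = suc m} f (fsuc u) f≡0 rewrite f≡0 fzero (λ ()) =
  ∑-single (f ∘ fsuc) u (λ x x≢u → f≡0 (fsuc x) (x≢u ∘ fsuc-injective))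

term≤∑ : ∀ {m} (f : Fin m → ℕ) (u : Fin m) → f u ≤ sum f
term≤∑ {m = suc m} f fzero    = m≤m+n (f fzero) _
term≤∑ {m = suc m} f (fsuc u) = ≤-trans (term≤∑ (f ∘ fsuc) u) (m≤n+m _ (f fzero))

∑-bound : ∀ {m} (f : Fin m → ℕ) (c : ℕ) → (∀ x → f x ≤ c) → sum f ≤ m * c
∑-bound {m = zero}  f c f≤c = z≤n
∑-bound {m = suc m} f c f≤c = +-mono-≤ (f≤c fzero) (∑-bound (f ∘ fsuc) c (f≤c ∘ fsuc))

list-sum≡∑ : ∀ {m} (f : Fin m → ℕ) → List.sum (map f (allFin m)) ≡ sum f
list-sum≡∑ f = trans (cong List.sum (List.map-tabulate id f)) (go f)
  where
  go : ∀ {k} (f : Fin k → ℕ) → List.sum (tabulate f) ≡ sum f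
  go {zero}  f = refl
  go {suc k} f = cong (f fzero +_) (go (f ∘ fsuc))

∑-at : ∀ {m} (u : Fin m) (f : Fin m → ℕ) → ∑[ x < m ] when (x ≟ u) (f x) ≡ f u
∑-at u f = trans (∑-single _ u (λ x x≢u → when-no (x ≟ u) x≢u (f x))) (when-yes (u ≟ u) refl (f u))

when-∑ : ∀ {m} {P : Set} (d : Dec P) (f : Fin m → ℕ) → when d (sum f) ≡ ∑[ x < m ] when d (f x)
when-∑ (yes _) f = refl
when-∑ {m} (no _)  f = sym (∑-zero {m} (λ _ → 0) (λ _ → refl))

module Rounding (g : ℕ) .{{_ : NonZero g}} where

  round-down-≤ : ∀ x → g * (x / g) ≤ x
  round-down-≤ x = subst (_≤ x) (*-comm (x / g) g) (m/n*n≤m x g)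

  <-round-up : ∀ x → x < g * suc (x / g)
  <-round-up x = begin-strict
    x                      ≡⟨ m≡m%n+[m/n]*n x g ⟩
    x % g + (x / g) * g    <⟨ +-monoˡ-< _ (m%n<n x g) ⟩
    g + (x / g) * g        ≡⟨ *-comm (suc (x / g)) g ⟩
    g * suc (x / g)        ∎
    where open ≤-Reasoning

  round-up-≤ : ∀ x → g * suc (x / g) ≤ x + g
  round-up-≤ x = begin
    g * suc (x / g)   ≡⟨ *-suc g (x / g) ⟩
    g + g * (x / g)   ≤⟨ +-monoʳ-≤ g (round-down-≤ x) ⟩
    g + x             ≡⟨ +-comm g x ⟩
    x + g             ∎
    where open ≤-Reasoning

  ≤-quotient : ∀ k x → g * k ≤ x → k ≤ x / g
  ≤-quotient k x gk≤x = begin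
    k              ≡⟨ m*n/n≡m k g ⟨
    (k * g) / g    ≤⟨ /-monoˡ-≤ g (subst (_≤ x) (*-comm g k) gk≤x) ⟩
    x / g          ∎
    where open ≤-Reasoning

^-reflect-< : ∀ a b → 2 ^ a < 2 ^ b → a < b
^-reflect-< a b 2^a<2^b with a <? b
... | yes a<b = a<b
... | no  a≮b = contradiction (^-monoʳ-≤ 2 (≮⇒≥ a≮b)) (<⇒≱ 2^a<2^b)

-- level w is the least ℓ ≥ 1 with w ≤ 2 ^ ℓ: the level of the dyadic
-- grid used for a light node of weight w.
level : ℕ → ℕ
level zero = 1
level (suc w) with suc w ≤? 2 ^ level w
... | yes _ = level w
... | no  _ = suc (level w)

level-pos : ∀ w → 1 ≤ level w
level-pos zero = s≤s z≤n
level-pos (suc w) with suc w ≤? 2 ^ level w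
... | yes _ = level-pos w
... | no  _ = s≤s z≤n

level-fits : ∀ w → w ≤ 2 ^ level w
level-fits zero = z≤n
level-fits (suc w) with suc w ≤? 2 ^ level w
... | yes fits = fits
... | no  _    = +-mono-≤ (m^n>0 2 (level w)) (≤-trans (level-fits w) (≤-reflexive (sym (+-identityʳ _))))

level-tight : ∀ w → 2 ≤ level w → 2 ^ level w < 2 * w
level-tight zero (s≤s ())
level-tight (suc w) 2≤ℓ with suc w ≤? 2 ^ level w
... | yes _      = <-≤-trans (level-tight w 2≤ℓ) (*-monoʳ-≤ 2 (n≤1+n w))
... | no  misfit = *-monoʳ-< 2 (≰⇒> misfit)

level≤1⇒≤2 : ∀ w → level w ≤ 1 → w ≤ 2
level≤1⇒≤2 w ℓ≤1 = subst (λ ℓ → w ≤ 2 ^ ℓ) (≤-antisym ℓ≤1 (level-pos w)) (level-fits w)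

level-≤ : ∀ w p → w ≤ 2 ^ p → 1 ≤ p → level w ≤ p
level-≤ w p w≤2^p 1≤p with level w ≤? 1
... | yes ℓ≤1 = ≤-trans ℓ≤1 1≤p
... | no  ℓ≰1 = s≤s⁻¹ (^-reflect-< (level w) (suc p) (<-≤-trans (level-tight w (≰⇒> ℓ≰1)) (*-monoʳ-≤ 2 w≤2^p)))

-- A light node of weight w ≥ 2 costs 2 * 2 ^ level w; this is paid for by
-- charging 4 to each of its w - 1 proper descendants.
light-cost : ∀ w → 2 ≤ w → 2 * 2 ^ level w ≤ 4 * (w ∸ 1)
light-cost w 2≤w with level w ≤? 1
... | yes ℓ≤1 rewrite ≤-antisym ℓ≤1 (level-pos w) = *-monoʳ-≤ 4 (∸-monoˡ-≤ 1 2≤w)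
... | no  ℓ≰1 = begin
  2 * 2 ^ level w              ≡⟨ cong (λ e → 2 * 2 ^ e) (sym (suc-pred (level w))) ⟩
  2 * (2 * 2 ^ pred (level w)) ≡⟨ *-assoc 2 2 (2 ^ pred (level w)) ⟨
  4 * 2 ^ pred (level w)       ≤⟨ *-monoʳ-≤ 4 (<⇒≤pred half<w) ⟩
  4 * (w ∸ 1)                  ∎
  where
  open ≤-Reasoning
  instance _ = >-nonZero (level-pos w)
  half<w : 2 ^ pred (level w) < w
  half<w = *-cancelˡ-< 2 _ w (subst (_< 2 * w) (cong (2 ^_) (sym (suc-pred (level w)))) (level-tight w (≰⇒> ℓ≰1)))

-- If a node of weight w has M light nodes strictly between itself and a
-- descendant whose parent has weight ≥ 2, then 3 * 2 ^ M ≤ w + 1, and so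
-- 2 + M is at most max(2, ℓ) for any ℓ with w ≤ 2 ^ ℓ.
few-light-levels : ∀ M w ℓ → 3 * 2 ^ M ≤ suc w → w ≤ 2 ^ ℓ → 2 + M ≤ 2 ⊔ ℓ
few-light-levels zero    w ℓ _ _ = m≤m⊔n 2 ℓ
few-light-levels (suc M) w ℓ 3x≤1+w w≤2^ℓ =
  ≤-trans (^-reflect-< (suc (suc M)) ℓ 2x<2^ℓ) (m≤n⊔m 2 ℓ)
  where
  x = 2 ^ suc M
  2x<2^ℓ : 2 * x < 2 ^ ℓ
  2x<2^ℓ = s≤s⁻¹ (begin
    2 + 2 * x   ≤⟨ +-monoˡ-≤ (2 * x) (*-monoʳ-≤ 2 (m^n>0 2 M)) ⟩
    x + 2 * x   ≤⟨ 3x≤1+w ⟩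
    suc w       ≤⟨ s≤s w≤2^ℓ ⟩
    suc (2 ^ ℓ) ∎)
    where open ≤-Reasoning

module Ancestry {m : ℕ} (T : RootedTree m) where
  open RootedTree T public

  iter-suc : ∀ k x → iter par (suc k) x ≡ iter par k (par x)
  iter-suc zero    x = refl
  iter-suc (suc k) x = cong par (iter-suc k x)

  iter-add : ∀ a b x → iter par (a + b) x ≡ iter par a (iter par b x)
  iter-add zero    b x = refl
  iter-add (suc a) b x = cong par (iter-add a b x)

  iter-root : ∀ k → iter par k root ≡ root
  iter-root zero    = refl
  iter-root (suc k) = trans (cong par (iter-root k)) par-root

  periodic⇒root : ∀ t y → iter par (suc t) y ≡ y → y ≡ root
  periodic⇒root t y cyc = begin
    y                                ≡⟨ periodic k ⟨
    iter par (k * suc t) y           ≡⟨ cong (λ e → iter par e y) (trans (*-suc k t) (+-comm k (k * t))) ⟩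
    iter par (k * t + k) y           ≡⟨ iter-add (k * t) k y ⟩
    iter par (k * t) (iter par k y)  ≡⟨ cong (iter par (k * t)) k-steps ⟩
    iter par (k * t) root            ≡⟨ iter-root (k * t) ⟩
    root                             ∎
    where
    open ≡-Reasoning
    k = proj₁ (reach y)
    k-steps = proj₂ (reach y)
    periodic : ∀ q → iter par (q * suc t) y ≡ y
    periodic zero    = refl
    periodic (suc q) = trans (iter-add (suc t) (q * suc t) y)
                             (trans (cong (iter par (suc t)) (periodic q)) cyc)

  par-≢ : ∀ t → t ≢ root → par t ≢ t
  par-≢ t t≢root par-t≡t = t≢root (periodic⇒root 0 t par-t≡t)

  _⊑_ : Fin m → Fin m → Set
  _⊑_ = InSubtree T

  ⊑-refl : ∀ {a} → a ⊑ a
  ⊑-refl = 0 , refl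

  ⊑-trans : ∀ {a b c} → a ⊑ b → b ⊑ c → a ⊑ c
  ⊑-trans {c = c} (k , b↦a) (l , c↦b) = k + l , trans (iter-add k l c) (trans (cong (iter par k) c↦b) b↦a)

  par-⊑ : ∀ t → par t ⊑ t
  par-⊑ t = 1 , refl

  root-⊑ : ∀ y → root ⊑ y
  root-⊑ = reach

  path-order : ∀ {j k v z s} → iter par j v ≡ z → iter par k v ≡ s → j < k ⊎ z ⊑ s
  path-order {j} {k} {v} {z} {s} v↦z v↦s with k ≤? j
  ... | no  k≰j = inj₁ (≰⇒> k≰j)
  ... | yes k≤j = inj₂ (j ∸ k , (begin
    iter par (j ∸ k) s                 ≡⟨ cong (iter par (j ∸ k)) v↦s ⟨
    iter par (j ∸ k) (iter par k v)    ≡⟨ iter-add (j ∸ k) k v ⟨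
    iter par (j ∸ k + k) v             ≡⟨ cong (λ e → iter par e v) (m∸n+n≡m k≤j) ⟩
    iter par j v                       ≡⟨ v↦z ⟩
    z                                  ∎))
    where open ≡-Reasoning

  ⊑-comparable : ∀ {a b y} → a ⊑ y → b ⊑ y → a ⊑ b ⊎ b ⊑ a
  ⊑-comparable {y = y} (j , y↦a) (k , y↦b) with path-order {j} {k} {y} y↦a y↦b
  ... | inj₂ a⊑b = inj₁ a⊑b
  ... | inj₁ j<k with path-order {k} {j} {y} y↦b y↦a
  ...   | inj₂ b⊑a = inj₂ b⊑a
  ...   | inj₁ k<j = contradiction j<k (<⇒≯ k<j)

module Preorder {m : ℕ} (T : RootedTree m) (heavy : Fin m → Bool)
                (dfs : Fin m → Fin m) (isDFS : IsDFS T heavy dfs) where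
  open Ancestry T public
  open IsDFS isDFS

  D : Fin m → ℕ
  D x = toℕ (dfs x)

  -- the weight is kept opaque so that it is never unfolded into its list sum
  opaque
    W : Fin m → ℕ
    W = weight T

    W≡weight : ∀ x → W x ≡ weight T x
    W≡weight x = refl

  -- end of the block of x, capped at m so that every number below E x is
  -- the DFS number of some node
  E : Fin m → ℕ
  E x = (D x + W x) ⊓ m

  ⊑⇒block : ∀ {a b} → a ⊑ b → D a ≤ D b × D b < E a
  ⊑⇒block {a} {b} a⊑b with proj₁ (contiguous a b) a⊑b
  ... | Da≤Db , Db<Da+Wa =
    Da≤Db , ⊓-pres-m< (subst (λ w → D b < D a + w) (sym (W≡weight a)) Db<Da+Wa) (toℕ<n _)

  block⇒⊑ : ∀ {a b} → D a ≤ D b → D b < E a → a ⊑ b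
  block⇒⊑ {a} {b} Da≤Db Db<Ea =
    proj₂ (contiguous a b) Da≤Db (subst (λ w → D b < D a + w) (W≡weight a) (m<n⊓o⇒m<n _ _ Db<Ea))

  _⊑?_ : ∀ a b → Dec (a ⊑ b)
  a ⊑? b = map′ (uncurry block⇒⊑) ⊑⇒block (D a ≤? D b ×-dec D b <? E a)

  D-injective : ∀ {x y} → D x ≡ D y → x ≡ y
  D-injective {x} {y} Dx≡Dy = injective x y (toℕ-injective Dx≡Dy)

  D<E : ∀ x → D x < E x
  D<E x = proj₂ (⊑⇒block ⊑-refl)

  ⊑-antisym : ∀ {a b} → a ⊑ b → b ⊑ a → a ≡ b
  ⊑-antisym a⊑b b⊑a = D-injective (≤-antisym (proj₁ (⊑⇒block a⊑b)) (proj₁ (⊑⇒block b⊑a)))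

  ⊏⇒D< : ∀ {a b} → a ⊑ b → a ≢ b → D a < D b
  ⊏⇒D< a⊑b a≢b = ≤∧≢⇒< (proj₁ (⊑⇒block a⊑b)) (a≢b ∘ D-injective)

  ¬⊑par : ∀ c → c ≢ root → ¬ c ⊑ par c
  ¬⊑par c c≢root c⊑par = par-≢ c c≢root (⊑-antisym (par-⊑ c) c⊑par)

  ⊏⇒⊑par : ∀ {z t} → t ≢ root → z ⊑ t → z ≢ t → z ⊑ par t
  ⊏⇒⊑par _ (zero  , t≡z)   z≢t = contradiction (sym t≡z) z≢t
  ⊏⇒⊑par {t = t} _ (suc k , t↦z) _ = k , trans (sym (iter-suc k t)) t↦z

  siblings-disjoint : ∀ {t h x} → t ≢ root → h ≢ root → par t ≡ par h → t ≢ h → t ⊑ x → h ⊑ x → ⊥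
  siblings-disjoint {t} {h} t≢root h≢root same-par t≢h t⊑x h⊑x with ⊑-comparable t⊑x h⊑x
  ... | inj₁ t⊑h = ¬⊑par t t≢root (subst (t ⊑_) (sym same-par) (⊏⇒⊑par h≢root t⊑h t≢h))
  ... | inj₂ h⊑t = ¬⊑par h h≢root (subst (h ⊑_) same-par (⊏⇒⊑par t≢root h⊑t (t≢h ∘ sym)))

  -- an injective self-map of Fin m is onto
  D-onto : ∀ k → k < m → ∃ λ x → D x ≡ k
  D-onto k k<m with any? (λ x → dfs x ≟ fromℕ< k<m)
  ... | yes (x , dfs-x≡k) = x , trans (cong toℕ dfs-x≡k) (toℕ-fromℕ< k<m)
  ... | no  missed        = ⊥-elim (onto m k<m dfs injective missed)
    where
    onto : ∀ m′ (k<m′ : k < m′) (f : Fin m′ → Fin m′) → (∀ u v → f u ≡ f v → u ≡ v) →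
           ¬ (∃ λ x → f x ≡ fromℕ< k<m′) → ⊥
    onto (suc m′) k<m′ f f-inj missed′ =
      <-irrefl refl (injective⇒≤ {f = λ u → punchOut (avoids u)}
                      (λ {u} {v} e → f-inj u v (punchOut-injective (avoids u) (avoids v) e)))
      where
      avoids : ∀ u → fromℕ< k<m′ ≢ f u
      avoids u e = missed′ (u , sym e)

  E-antitone : ∀ {a b} → a ⊑ b → E b ≤ E a
  E-antitone {a} {b} a⊑b with m ≤? D a + W a
  ... | yes full = subst (E b ≤_) (sym (m≥n⇒m⊓n≡n full)) (m⊓n≤n _ m)
  ... | no  short with E b ≤? E a
  ...   | yes Eb≤Ea = Eb≤Ea
  ...   | no  Eb≰Ea = ⊥-elim (<-irrefl (trans Dz≡Ea (sym Ea≡)) (proj₂ (⊑⇒block (⊑-trans a⊑b b⊑z))))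
    where
    Ea≡ : E a ≡ D a + W a
    Ea≡ = m≤n⇒m⊓n≡m (<⇒≤ (≰⇒> short))
    -- the node numbered E a would lie in the block of b but not in that of a
    z = proj₁ (D-onto (D a + W a) (≰⇒> short))
    Dz≡Ea : D z ≡ D a + W a
    Dz≡Ea = proj₂ (D-onto (D a + W a) (≰⇒> short))
    b⊑z : b ⊑ z
    b⊑z = block⇒⊑ (subst (D b ≤_) (trans Ea≡ (sym Dz≡Ea)) (<⇒≤ (proj₂ (⊑⇒block a⊑b))))
                  (subst (_< E b) (trans Ea≡ (sym Dz≡Ea)) (≰⇒> Eb≰Ea))

  -- a walk to an ancestor can be shortened to fewer than m steps,
  -- since D decreases strictly along it
  short-walk : ∀ k w x → iter par k w ≡ x → ∃ λ k′ → iter par k′ w ≡ x × k′ + D x ≤ D w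
  short-walk zero w x w↦x = 0 , w↦x , ≤-reflexive (cong D (sym w↦x))
  short-walk (suc k) w x w↦x with w ≟ x
  ... | yes w≡x = 0 , w≡x , ≤-reflexive (cong D (sym w≡x))
  ... | no  w≢x with short-walk k (par w) x (trans (sym (iter-suc k w)) w↦x)
  ...   | k′ , pw↦x , bound = suc k′ , trans (iter-suc k′ w) pw↦x ,
                              ≤-trans (s≤s bound) (⊏⇒D< (par-⊑ w) (par-≢ w w≢root))
    where
    w≢root : w ≢ root
    w≢root w≡root = w≢x (begin
      w                     ≡⟨ w≡root ⟩
      root                  ≡⟨ iter-root (suc k) ⟨
      iter par (suc k) root ≡⟨ cong (iter par (suc k)) w≡root ⟨
      iter par (suc k) w    ≡⟨ w↦x ⟩
      x                     ∎)
      where open ≡-Reasoning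

  inSubtree?-sound : ∀ x w → Holds (inSubtree? T x w) → x ⊑ w
  inSubtree?-sound x w found with satisfied (any⁻ _ (upTo m) found)
  ... | k , hit = k , toWitness hit

  inSubtree?-complete : ∀ x w → x ⊑ w → Holds (inSubtree? T x w)
  inSubtree?-complete x w (k , w↦x) with short-walk k w x w↦x
  ... | k′ , w↦x′ , bound =
    any⁺ _ (lose (∈-upTo⁺ (≤-<-trans (≤-trans (m≤m+n k′ (D x)) bound) (toℕ<n _))) (fromWitness w↦x′))

  in-sub : Fin m → Fin m → ℕ
  in-sub t x = when (t ⊑? x) 1

  at : Fin m → Fin m → ℕ
  at t x = when (x ≟ t) 1

  W-count : ∀ x → W x ≡ sum (in-sub x)
  W-count x = trans (W≡weight x) (trans (list-sum≡∑ counted) (sum-cong-≗ {m} {counted} indicator))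
    where
    counted : Fin m → ℕ
    counted w = if inSubtree? T x w then 1 else 0
    indicator : ∀ w → counted w ≡ in-sub x w
    indicator w with inSubtree? T x w in test | x ⊑? w
    ... | true  | yes _    = refl
    ... | true  | no  x⋢w  = contradiction (inSubtree?-sound x w (subst Holds (sym test) tt)) x⋢w
    ... | false | yes x⊑w  = ⊥-elim (subst Holds test (inSubtree?-complete x w x⊑w))
    ... | false | no  _    = refl

  W-pos : ∀ t → 1 ≤ W t
  W-pos t = subst (1 ≤_) (sym (W-count t))
              (≤-trans (≤-reflexive (sym (when-yes (t ⊑? t) ⊑-refl 1))) (term≤∑ (in-sub t) t))

  W≤m : ∀ x → W x ≤ m
  W≤m x = subst (_≤ m) (sym (W-count x))
            (≤-trans (∑-bound (in-sub x) 1 (λ w → when-≤ (x ⊑? w) 1)) (≤-reflexive (*-identityʳ m)))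

  W-par : ∀ t → t ≢ root → suc (W t) ≤ W (par t)
  W-par t t≢root = begin
    suc (W t)                                 ≡⟨ cong₂ _+_ (sym (∑-at (par t) (λ _ → 1))) (W-count t) ⟩
    sum (at (par t)) + sum (in-sub t)         ≡⟨ ∑-distrib-+ (at (par t)) (in-sub t) ⟨
    ∑[ x < m ] (at (par t) x + in-sub t x)    ≤⟨ ∑-mono pointwise ⟩
    sum (in-sub (par t))                      ≡⟨ W-count (par t) ⟨
    W (par t)                                 ∎
    where
    open ≤-Reasoning
    pointwise : ∀ x → at (par t) x + in-sub t x ≤ in-sub (par t) x
    pointwise x = when-disjoint (x ≟ par t) (t ⊑? x) (par t ⊑? x)
                    (λ { refl → ⊑-refl }) (⊑-trans (par-⊑ t)) (λ { refl → ¬⊑par t t≢root }) 1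

  W-children : ∀ {t h} → t ≢ root → h ≢ root → par t ≡ par h → t ≢ h → suc (W t + W h) ≤ W (par t)
  W-children {t} {h} t≢root h≢root same-par t≢h = begin
    suc (W t + W h)                                          ≡⟨ cong₂ _+_ (sym (∑-at v (λ _ → 1)))
                                                                  (cong₂ _+_ (W-count t) (W-count h)) ⟩
    sum (at v) + (sum (in-sub t) + sum (in-sub h))           ≡⟨ cong (sum (at v) +_) (∑-distrib-+ (in-sub t) (in-sub h)) ⟨
    sum (at v) + ∑[ x < m ] (in-sub t x + in-sub h x)        ≡⟨ ∑-distrib-+ (at v) _ ⟨
    ∑[ x < m ] (at v x + (in-sub t x + in-sub h x))          ≤⟨ ∑-mono pointwise ⟩
    sum (in-sub v)                                           ≡⟨ W-count v ⟨
    W v                                                      ∎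
    where
    open ≤-Reasoning
    v = par t
    below-v : ∀ {x} → t ⊑ x ⊎ h ⊑ x → v ⊑ x
    below-v (inj₁ t⊑x) = ⊑-trans (par-⊑ t) t⊑x
    below-v (inj₂ h⊑x) = ⊑-trans (subst (_⊑ h) (sym same-par) (par-⊑ h)) h⊑x
    not-v : ∀ {x} → x ≡ v → t ⊑ x ⊎ h ⊑ x → ⊥
    not-v refl (inj₁ t⊑v) = ¬⊑par t t≢root t⊑v
    not-v refl (inj₂ h⊑v) = ¬⊑par h h≢root (subst (h ⊑_) same-par h⊑v)
    pointwise : ∀ x → at v x + (in-sub t x + in-sub h x) ≤ in-sub v x
    pointwise x = ≤-trans
      (+-monoʳ-≤ (at v x)
        (when-disjoint (t ⊑? x) (h ⊑? x) (t ⊑? x ⊎-dec h ⊑? x) inj₁ inj₂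
                       (siblings-disjoint t≢root h≢root same-par t≢h) 1))
      (when-disjoint (x ≟ v) (t ⊑? x ⊎-dec h ⊑? x) (v ⊑? x) (λ { refl → ⊑-refl }) below-v not-v 1)

module Layout {m : ℕ} (T : RootedTree m) (heavy : Fin m → Bool)
              (dfs : Fin m → Fin m) (isDFS : IsDFS T heavy dfs) where
  open Preorder T heavy dfs isDFS public

  heavy-or-light : ∀ u → heavy u ≡ true ⊎ heavy u ≡ false
  heavy-or-light u with heavy u
  ... | true  = inj₁ refl
  ... | false = inj₂ refl

  lvl : Fin m → ℕ
  lvl u = if heavy u then 1 else level (W u)

  grid : Fin m → ℕ
  grid u = 2 ^ lvl u

  instance
    grid-nonZero : ∀ {u} → NonZero (grid u)
    grid-nonZero {u} = m^n≢0 2 (lvl u)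

  opening closing cost : Fin m → ℕ
  opening u = if heavy u then 4 else grid u
  closing u = if heavy u then 0 else grid u
  cost u = opening u + closing u

  module _ {u : Fin m} where
    lvl-heavy : heavy u ≡ true → lvl u ≡ 1
    lvl-heavy h rewrite h = refl
    opening-heavy : heavy u ≡ true → opening u ≡ 4
    opening-heavy h rewrite h = refl
    lvl-light : heavy u ≡ false → lvl u ≡ level (W u)
    lvl-light l rewrite l = refl
    opening-light : heavy u ≡ false → opening u ≡ grid u
    opening-light l rewrite l = refl
    closing-light : heavy u ≡ false → closing u ≡ grid u
    closing-light l rewrite l = refl
    cost-heavy : heavy u ≡ true → cost u ≡ 4
    cost-heavy h rewrite h = refl
    cost-light : heavy u ≡ false → cost u ≡ 2 * 2 ^ level (W u)
    cost-light l rewrite l = cong (2 ^ level (W u) +_) (sym (+-identityʳ _))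

  grid≤opening : ∀ u → grid u ≤ opening u
  grid≤opening u with heavy-or-light u
  ... | inj₁ h = subst₂ _≤_ (cong (2 ^_) (sym (lvl-heavy h))) (sym (opening-heavy h)) (s≤s (s≤s z≤n))
  ... | inj₂ l = ≤-reflexive (sym (opening-light l))

  before : Fin m → Fin m → ℕ
  before v x = when (D x <? D v) (opening x) + when (E x ≤? D v) (closing x)

  inside : Fin m → Fin m → ℕ
  inside u x = when (u ⊑? x) (cost x)

  pos span : Fin m → ℕ
  pos v = sum (before v)
  span u = sum (inside u)

  total : ℕ
  total = sum cost

  before-mono : ∀ {u v} x → D u ≤ D v → before u x ≤ before v x
  before-mono {u} {v} x Du≤Dv =
    +-mono-≤ (when-imp (D x <? D u) (D x <? D v) (λ Dx<Du → <-≤-trans Dx<Du Du≤Dv) _)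
             (when-imp (E x ≤? D u) (E x ≤? D v) (λ Ex≤Du → ≤-trans Ex≤Du Du≤Dv) _)

  before-desc : ∀ {u x} → u ⊑ x → before u x ≡ 0
  before-desc {u} {x} u⊑x =
    cong₂ _+_ (when-no (D x <? D u) (≤⇒≯ (proj₁ (⊑⇒block u⊑x))) _)
              (when-no (E x ≤? D u) (<⇒≱ (≤-<-trans (proj₁ (⊑⇒block u⊑x)) (D<E x))) _)

  before-after : ∀ {u v x} → u ⊑ x → E u ≤ D v → before v x ≡ cost x
  before-after {u} {v} {x} u⊑x Eu≤Dv =
    cong₂ _+_ (when-yes (D x <? D v) (<-≤-trans (proj₂ (⊑⇒block u⊑x)) Eu≤Dv) _)
              (when-yes (E x ≤? D v) (≤-trans (E-antitone u⊑x) Eu≤Dv) _)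

  opening≤before : ∀ {x v} → D x < D v → opening x ≤ before v x
  opening≤before {x} {v} Dx<Dv =
    ≤-trans (≤-reflexive (sym (when-yes (D x <? D v) Dx<Dv _))) (m≤m+n _ _)

  before-outside : ∀ {u v x} → ¬ u ⊑ x → u ⊑ v → before v x ≤ before u x
  before-outside {u} {v} {x} u⋢x u⊑v =
    +-mono-≤ (when-imp (D x <? D v) (D x <? D u) entered _) (when-imp (E x ≤? D v) (E x ≤? D u) closed _)
    where
    Dv<Eu = proj₂ (⊑⇒block u⊑v)
    entered : D x < D v → D x < D u
    entered Dx<Dv with D x <? D u
    ... | yes Dx<Du = Dx<Du
    ... | no  Dx≮Du = contradiction (block⇒⊑ (≮⇒≥ Dx≮Du) (<-trans Dx<Dv Dv<Eu)) u⋢x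
    closed : E x ≤ D v → E x ≤ D u
    closed Ex≤Dv with E x ≤? D u
    ... | yes Ex≤Du = Ex≤Du
    ... | no  Ex≰Du with D x <? D u
    ...   | yes Dx<Du = ⊥-elim (<-irrefl refl
              (<-≤-trans Dv<Eu (≤-trans (E-antitone (block⇒⊑ (<⇒≤ Dx<Du) (≰⇒> Ex≰Du))) Ex≤Dv)))
    ...   | no  Dx≮Du with E u ≤? D x
    ...     | yes Eu≤Dx = ⊥-elim (<-irrefl refl (<-trans Dv<Eu (≤-<-trans Eu≤Dx (<-≤-trans (D<E x) Ex≤Dv))))
    ...     | no  Eu≰Dx = contradiction (block⇒⊑ (≮⇒≥ Dx≮Du) (≰⇒> Eu≰Dx)) u⋢x

  before+inside≤cost : ∀ u x → before u x + inside u x ≤ cost x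
  before+inside≤cost u x with u ⊑? x
  ... | yes u⊑x = ≤-reflexive (cong (_+ cost x) (before-desc u⊑x))
  ... | no  _   = ≤-trans (≤-reflexive (+-identityʳ _)) (+-mono-≤ (when-≤ (D x <? D u) _) (when-≤ (E x ≤? D u) _))

  pos-step : ∀ {u v} → D u < D v → pos u + opening u ≤ pos v
  pos-step {u} {v} Du<Dv = begin
    pos u + opening u                                  ≡⟨ cong (pos u +_) (∑-at u opening) ⟨
    pos u + ∑[ x < m ] when (x ≟ u) (opening x)        ≡⟨ ∑-distrib-+ (before u) (λ x → when (x ≟ u) (opening x)) ⟨
    ∑[ x < m ] (before u x + when (x ≟ u) (opening x)) ≤⟨ ∑-mono pointwise ⟩
    pos v                                              ∎
    where
    open ≤-Reasoning
    pointwise : ∀ x → before u x + when (x ≟ u) (opening x) ≤ before v x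
    pointwise x with x ≟ u
    ... | yes refl = ≤-trans (≤-reflexive (cong (_+ opening x) (before-desc ⊑-refl))) (opening≤before Du<Dv)
    ... | no  _    = ≤-trans (≤-reflexive (+-identityʳ _)) (before-mono x (<⇒≤ Du<Dv))

  pos-after : ∀ {u v} → E u ≤ D v → pos u + span u ≤ pos v
  pos-after {u} {v} Eu≤Dv = begin
    pos u + span u                       ≡⟨ ∑-distrib-+ (before u) (inside u) ⟨
    ∑[ x < m ] (before u x + inside u x) ≤⟨ ∑-mono pointwise ⟩
    pos v                                ∎
    where
    open ≤-Reasoning
    pointwise : ∀ x → before u x + inside u x ≤ before v x
    pointwise x with u ⊑? x
    ... | yes u⊑x = ≤-reflexive (trans (cong (_+ cost x) (before-desc u⊑x)) (sym (before-after u⊑x Eu≤Dv)))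
    ... | no  _   = ≤-trans (≤-reflexive (+-identityʳ _)) (before-mono x (<⇒≤ (<-≤-trans (D<E u) Eu≤Dv)))

  span-nested : ∀ {u v} → u ⊑ v → u ≢ v → pos v + span v + closing u ≤ pos u + span u
  span-nested {u} {v} u⊑v u≢v = begin
    pos v + span v + closing u                       ≡⟨ cong₂ _+_ (∑-distrib-+ (before v) (inside v)) (∑-at u closing) ⟨
    sum (λ x → before v x + inside v x) + ∑[ x < m ] when (x ≟ u) (closing x)
                                                     ≡⟨ ∑-distrib-+ (λ x → before v x + inside v x) _ ⟨
    ∑[ x < m ] (before v x + inside v x + when (x ≟ u) (closing x))
                                                     ≤⟨ ∑-mono pointwise ⟩
    ∑[ x < m ] (before u x + inside u x)             ≡⟨ ∑-distrib-+ (before u) (inside u) ⟩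
    pos u + span u                                   ∎
    where
    open ≤-Reasoning
    Dv<Eu = proj₂ (⊑⇒block u⊑v)
    pointwise : ∀ x → before v x + inside v x + when (x ≟ u) (closing x) ≤ before u x + inside u x
    pointwise x with x ≟ u
    ... | yes refl = begin
      before v x + inside v x + closing x            ≡⟨ cong (λ i → before v x + i + closing x)
                                                           (when-no (v ⊑? x) (λ v⊑u → u≢v (⊑-antisym u⊑v v⊑u)) _) ⟩
      before v x + 0 + closing x                     ≤⟨ +-monoˡ-≤ (closing x) (+-monoˡ-≤ 0 (+-mono-≤
                                                           (when-≤ (D x <? D v) _)
                                                           (≤-reflexive (when-no (E x ≤? D v) (<⇒≱ Dv<Eu) _)))) ⟩
      opening x + 0 + 0 + closing x                  ≡⟨ cong (λ z → z + closing x) (trans (+-identityʳ _) (+-identityʳ _)) ⟩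
      cost x                                         ≡⟨ cong (_+ cost x) (before-desc ⊑-refl) ⟨
      before x x + cost x                            ≡⟨ cong (before x x +_) (when-yes (x ⊑? x) ⊑-refl _) ⟨
      before x x + inside x x                        ∎
    ... | no _ with u ⊑? x
    ...   | yes u⊑x = begin
      before v x + inside v x + 0   ≡⟨ +-identityʳ _ ⟩
      before v x + inside v x       ≤⟨ before+inside≤cost v x ⟩
      cost x                        ≤⟨ m≤n+m (cost x) (before u x) ⟩
      before u x + cost x           ∎
    ...   | no  u⋢x = begin
      before v x + inside v x + 0   ≡⟨ +-identityʳ _ ⟩
      before v x + inside v x       ≡⟨ cong (before v x +_) (when-no (v ⊑? x) (λ v⊑x → u⋢x (⊑-trans u⊑v v⊑x)) _) ⟩
      before v x + 0                ≡⟨ +-identityʳ _ ⟩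
      before v x                    ≤⟨ before-outside u⋢x u⊑v ⟩
      before u x                    ≡⟨ +-identityʳ _ ⟨
      before u x + 0                ∎

  pos+span≤total : ∀ u → pos u + span u ≤ total
  pos+span≤total u = ≤-trans (≤-reflexive (sym (∑-distrib-+ (before u) (inside u)))) (∑-mono (before+inside≤cost u))

  cost≤span : ∀ u → cost u ≤ span u
  cost≤span u = ≤-trans (≤-reflexive (sym (when-yes (u ⊑? u) ⊑-refl (cost u)))) (term≤∑ (inside u) u)

  lo len : Fin m → ℕ
  lo u = suc (pos u / grid u)
  len u = if heavy u then 1 else (pos u + span u) / grid u ∸ lo u

  interval : Fin m → Interval
  interval u = I[ lvl u , lo u , len u ]

  left right : Fin m → ℕ
  left u = proj₁ (interval u)
  right u = proj₂ (interval u)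

  module _ {u : Fin m} where
    len-heavy : heavy u ≡ true → len u ≡ 1
    len-heavy h rewrite h = refl
    len-light : heavy u ≡ false → len u ≡ (pos u + span u) / grid u ∸ lo u
    len-light l rewrite l = refl

  pos<left : ∀ u → pos u < left u
  pos<left u = Rounding.<-round-up (grid u) (pos u)

  left≤pos+opening : ∀ u → left u ≤ pos u + opening u
  left≤pos+opening u = ≤-trans (Rounding.round-up-≤ (grid u) (pos u)) (+-monoʳ-≤ (pos u) (grid≤opening u))

  right≡left+ : ∀ u → right u ≡ left u + grid u * len u
  right≡left+ u = *-distribˡ-+ (grid u) (lo u) (len u)

  light-room : ∀ u → heavy u ≡ false → suc (lo u) ≤ (pos u + span u) / grid u
  light-room u l = Rounding.≤-quotient (grid u) (suc (lo u)) (pos u + span u) (begin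
    grid u * suc (lo u)          ≡⟨ *-suc (grid u) (lo u) ⟩
    grid u + left u              ≤⟨ +-monoʳ-≤ (grid u) (Rounding.round-up-≤ (grid u) (pos u)) ⟩
    grid u + (pos u + grid u)    ≡⟨ +-comm (grid u) _ ⟩
    pos u + grid u + grid u      ≡⟨ +-assoc (pos u) (grid u) (grid u) ⟩
    pos u + (grid u + grid u)    ≡⟨ cong (pos u +_) (cong₂ _+_ (opening-light l) (closing-light l)) ⟨
    pos u + cost u               ≤⟨ +-monoʳ-≤ (pos u) (cost≤span u) ⟩
    pos u + span u               ∎)
    where open ≤-Reasoning

  right-light : ∀ u → heavy u ≡ false → right u ≡ grid u * ((pos u + span u) / grid u)
  right-light u l = cong (grid u *_) (trans (cong (lo u +_) (len-light l)) (m+[n∸m]≡n (≤-trans (n≤1+n _) (light-room u l))))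

  right-heavy : ∀ u → heavy u ≡ true → right u ≤ pos u + opening u
  right-heavy u h = begin
    right u                        ≡⟨ right≡left+ u ⟩
    left u + grid u * len u        ≡⟨ cong (λ b → left u + grid u * b) (len-heavy h) ⟩
    left u + grid u * 1            ≤⟨ +-mono-≤ (Rounding.round-up-≤ (grid u) (pos u)) (≤-reflexive (*-identityʳ (grid u))) ⟩
    pos u + grid u + grid u        ≡⟨ +-assoc (pos u) (grid u) (grid u) ⟩
    pos u + (grid u + grid u)      ≡⟨ cong (λ l → pos u + (2 ^ l + 2 ^ l)) (lvl-heavy h) ⟩
    pos u + 4                      ≡⟨ cong (pos u +_) (opening-heavy h) ⟨
    pos u + opening u              ∎
    where open ≤-Reasoning

  right≤pos+span : ∀ u → right u ≤ pos u + span u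
  right≤pos+span u with heavy-or-light u
  ... | inj₁ h = ≤-trans (right-heavy u h) (+-monoʳ-≤ (pos u) (≤-trans (m≤m+n (opening u) (closing u)) (cost≤span u)))
  ... | inj₂ l = subst (_≤ pos u + span u) (sym (right-light u l)) (Rounding.round-down-≤ (grid u) (pos u + span u))

  pos+span<right+grid : ∀ u → heavy u ≡ false → pos u + span u < right u + grid u
  pos+span<right+grid u l = subst (pos u + span u <_) right+grid≡
                              (Rounding.<-round-up (grid u) (pos u + span u))
    where
    right+grid≡ : grid u * suc ((pos u + span u) / grid u) ≡ right u + grid u
    right+grid≡ = trans (*-suc (grid u) _) (trans (+-comm (grid u) _) (cong (_+ grid u) (sym (right-light u l))))

  len-pos : ∀ u → 1 ≤ len u
  len-pos u with heavy-or-light u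
  ... | inj₁ h = ≤-reflexive (sym (len-heavy h))
  ... | inj₂ l = subst (1 ≤_) (sym (len-light l)) (m<n⇒0<n∸m (light-room u l))

  grid*len<span : ∀ u → heavy u ≡ false → grid u * len u < span u
  grid*len<span u l = +-cancelˡ-< (pos u) _ _ (begin-strict
    pos u + grid u * len u     <⟨ +-monoˡ-< (grid u * len u) (pos<left u) ⟩
    left u + grid u * len u    ≡⟨ right≡left+ u ⟨
    right u                    ≤⟨ right≤pos+span u ⟩
    pos u + span u             ∎)
    where open ≤-Reasoning

  left-increasing : ∀ {u v} → D u < D v → left u < left v
  left-increasing {u} {v} Du<Dv =
    ≤-<-trans (left≤pos+opening u) (≤-<-trans (pos-step Du<Dv) (pos<left v))

  interval-injective : ∀ u v → interval u ≡ interval v → u ≡ v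
  interval-injective u v same with <-cmp (D u) (D v)
  ... | tri< Du<Dv _ _ = ⊥-elim (<-irrefl (cong proj₁ same) (left-increasing Du<Dv))
  ... | tri≈ _ Du≡Dv _ = D-injective Du≡Dv
  ... | tri> _ _ Dv<Du = ⊥-elim (<-irrefl (cong proj₁ (sym same)) (left-increasing Dv<Du))

  light-contains : ∀ s u → heavy s ≡ false → s ⊑ u → s ≢ u → interval u ⊆I interval s
  light-contains s u l s⊑u s≢u = left-le , right-le
    where
    open ≤-Reasoning
    left-le : left s ≤ left u
    left-le = ≤-trans (left≤pos+opening s) (≤-trans (pos-step (⊏⇒D< s⊑u s≢u)) (<⇒≤ (pos<left u)))
    right-le : right u ≤ right s
    right-le = <⇒≤ (+-cancelʳ-< (grid s) (right u) (right s) (begin-strict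
      right u + grid s             ≤⟨ +-monoˡ-≤ (grid s) (right≤pos+span u) ⟩
      pos u + span u + grid s      ≡⟨ cong (pos u + span u +_) (closing-light l) ⟨
      pos u + span u + closing s   ≤⟨ span-nested s⊑u s≢u ⟩
      pos s + span s               <⟨ pos+span<right+grid s l ⟩
      right s + grid s             ∎))

  heavy-precedes : ∀ x u → heavy x ≡ true → D x < D u → interval x ≺ interval u
  heavy-precedes x u h Dx<Du = ≤-<-trans (right-heavy x h) (≤-<-trans (pos-step Dx<Du) (pos<left u))

  closed-precedes : ∀ x u → E x ≤ D u → interval x ≺ interval u
  closed-precedes x u Ex≤Du = ≤-<-trans (right≤pos+span x) (≤-<-trans (pos-after Ex≤Du) (pos<left u))

module LocalOrder {m : ℕ} (T : RootedTree m) (heavy : Fin m → Bool)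
                  (dfs : Fin m → Fin m) (isDFS : IsDFS T heavy dfs) where
  open Layout T heavy dfs isDFS

  light≢heavy : ∀ {x y} → heavy x ≡ false → heavy y ≡ true → x ≢ y
  light≢heavy x-light y-heavy refl = contradiction (trans (sym x-light) y-heavy) λ ()

  sp-⊑ : ∀ {v s} → IsSp T heavy v s → s ⊑ v
  sp-⊑ (k , v↦s , _) = k , v↦s

  sp-light : ∀ {v s} → heavy v ≡ false → IsSp T heavy v s → s ≡ v
  sp-light v-light (zero  , v≡s , _)          = sym v≡s
  sp-light v-light (suc k , _ , _ , below-sp) = ⊥-elim (light≢heavy v-light (below-sp 0 (s≤s z≤n)) refl)

  below-sp-heavy : ∀ {v s z} → IsSp T heavy v s → s ⊑ z → z ⊑ v → z ≢ s → heavy z ≡ true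
  below-sp-heavy {v} (k , v↦s , _ , below-sp) s⊑z (j , v↦z) z≢s with path-order {j} {k} {v} v↦z v↦s
  ... | inj₁ j<k = subst (λ y → heavy y ≡ true) v↦z (below-sp j j<k)
  ... | inj₂ z⊑s = contradiction (⊑-antisym z⊑s s⊑z) z≢s

  on-path : ∀ {v s x} → s ⊑ v → OnPath T heavy v s x → s ⊑ x × x ⊑ v
  on-path {v} (k , v↦s) (j , v↦x , avoids-s) with path-order {k} {j} {v} v↦s v↦x
  ... | inj₁ k<j = contradiction v↦s (avoids-s k k<j)
  ... | inj₂ s⊑x = s⊑x , (j , v↦x)

  -- (LPO1): both supervisors are light ancestors containing the interval of u
  lpo1 : ∀ u → LPO1 T heavy dfs interval u
  lpo1 u u≢root s s′ sp-u@(_ , _ , s-light , _) sp-par@(_ , _ , s′-light , _) = own , parent′s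
    where
    own : interval u ⊆I interval s
    own with heavy-or-light u
    ... | inj₁ u-heavy = light-contains s u s-light (sp-⊑ sp-u) (light≢heavy s-light u-heavy)
    ... | inj₂ u-light rewrite sp-light u-light sp-u = ≤-refl , ≤-refl
    parent′s : interval u ⊆I interval s′
    parent′s = light-contains s′ u s′-light (⊑-trans (sp-⊑ sp-par) (par-⊑ u))
                 (λ { refl → ¬⊑par u u≢root (sp-⊑ sp-par) })

  -- (LPO2): a heavy x in lqa(u) is entered before u, and a light x is a light
  -- child of the path whose subtree is finished before u is entered
  lpo2 : ∀ u → LPO2 T heavy dfs interval u
  lpo2 u x (u≢root , s , sp , where-x , x≢u , x≢s , Dx≤Du) with heavy-or-light x
  ... | inj₁ x-heavy = heavy-precedes x u x-heavy (≤∧≢⇒< Dx≤Du (x≢u ∘ D-injective))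
  ... | inj₂ x-light with where-x
  -- x on the path below the supervisor would be heavy
  ...   | inj₁ x-on-path with on-path (sp-⊑ sp) x-on-path
  ...     | s⊑x , x⊑pu = ⊥-elim (light≢heavy x-light (below-sp-heavy sp s⊑x x⊑pu x≢s) refl)
  -- a light child of the path is not an ancestor of u, so its block is over
  lpo2 u x (u≢root , s , sp , _ , x≢u , x≢s , Dx≤Du) | inj₂ x-light | inj₂ (_ , _ , parent-on-path) =
    closed-precedes x u block-over
    where
    block-over : E x ≤ D u
    block-over with E x ≤? D u
    ... | yes Ex≤Du = Ex≤Du
    ... | no  Ex≰Du = ⊥-elim (light≢heavy x-light (below-sp-heavy sp s⊑x x⊑pu x≢s) refl)
      where
      x⊑pu = ⊏⇒⊑par u≢root (block⇒⊑ Dx≤Du (≰⇒> Ex≰Du)) x≢u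
      s⊑x = ⊑-trans (proj₁ (on-path (sp-⊑ sp) parent-on-path)) (par-⊑ x)

-- The space a light node of weight w reserves for its subtree.
budget : ℕ → ℕ
budget w = 4 * (when (w ℕ.≟ 1) 1 + (2 ⊔ level w) * (w ∸ 1))

budget-≤ : ∀ w → budget w ≤ 4 * (level w * 2 ^ level w)
budget-≤ zero = z≤n
budget-≤ (suc zero) = s≤s (s≤s (s≤s (s≤s z≤n)))
budget-≤ (suc (suc w)) = *-monoʳ-≤ 4 (factor-bound (level (2 + w) ℕ.≤? 1))
  where
  ℓ = level (2 + w)
  factor-bound : Dec (ℓ ≤ 1) → (2 ⊔ ℓ) * suc w ≤ ℓ * 2 ^ ℓ
  factor-bound (yes ℓ≤1) rewrite n≤0⇒n≡0 (≤-pred (≤-pred (level≤1⇒≤2 (2 + w) ℓ≤1))) = ≤-refl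
  factor-bound (no ℓ≰1) rewrite m≤n⇒m⊔n≡n (≰⇒> ℓ≰1) = *-monoʳ-≤ ℓ (≤-trans (n≤1+n _) (level-fits (2 + w)))

-- Every node z pays cost z; we charge it to the
-- nodes of its subtree: z itself takes self-share z and every proper
-- descendant lightness z, and four times this covers cost z.  A node t in
-- the subtree of a light node y is charged by t itself and by the light
-- nodes between y and t; weights at least double at each light node, so
-- there are few of them, and span y ≤ budget (W y).
module SizeBound {m : ℕ} (T : RootedTree m) (heavy : Fin m → Bool) (heavyChoice : HeavyChoice T heavy)
                 (dfs : Fin m → Fin m) (isDFS : IsDFS T heavy dfs) where
  open Layout T heavy dfs isDFS public
  open HeavyChoice heavyChoice

  W-light : ∀ t → t ≢ root → heavy t ≡ false → suc (W t + W t) ≤ W (par t)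
  W-light t t≢root t-light with one-heavy (par t) t (t≢root , refl)
  ... | h , (h≢root , ph≡pt) , h-heavy , heaviest , _ =
    ≤-trans (s≤s (+-monoʳ-≤ (W t) (subst₂ _≤_ (sym (W≡weight t)) (sym (W≡weight h)) (heaviest t (t≢root , refl)))))
            (W-children t≢root h≢root (sym ph≡pt) t≢h)
    where
    t≢h : t ≢ h
    t≢h refl = contradiction (trans (sym t-light) h-heavy) λ ()

  lightness : Fin m → ℕ
  lightness z = if heavy z then 0 else 1

  self-share : Fin m → ℕ
  self-share z = if heavy z then 1 else when (W z ℕ.≟ 1) 1

  share : Fin m → Fin m → ℕ
  share z t = when (t ≟ z) (self-share z) + when (¬? (t ≟ z)) (lightness z)

  charge : Fin m → ℕ
  charge z = ∑[ t < m ] when (z ⊑? t) (share z t)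

  proper : Fin m → Fin m → ℕ
  proper z t = when (z ⊑? t) (when (¬? (t ≟ z)) 1)

  W-split : ∀ z → W z ≡ suc (sum (proper z))
  W-split z = begin
    W z                                   ≡⟨ W-count z ⟩
    sum (in-sub z)                        ≡⟨ sum-cong-≗ {m} {in-sub z} pointwise ⟩
    ∑[ t < m ] (at z t + proper z t)      ≡⟨ ∑-distrib-+ (at z) (proper z) ⟩
    sum (at z) + sum (proper z)           ≡⟨ cong (_+ sum (proper z)) (∑-at z (λ _ → 1)) ⟩
    suc (sum (proper z))                  ∎
    where
    open ≡-Reasoning
    pointwise : ∀ t → in-sub z t ≡ at z t + proper z t
    pointwise t with t ≟ z | z ⊑? t
    ... | yes refl | yes _   = refl
    ... | yes refl | no  z⋢z = contradiction ⊑-refl z⋢z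
    ... | no  _    | yes _   = refl
    ... | no  _    | no  _   = refl

  share-self : ∀ z → share z z ≡ self-share z
  share-self z = trans (cong₂ _+_ (when-yes (z ≟ z) refl _) (when-no (¬? (z ≟ z)) (λ z≢z → z≢z refl) _)) (+-identityʳ _)

  share-other : ∀ {z t} → t ≢ z → share z t ≡ lightness z
  share-other {z} {t} t≢z = cong₂ _+_ (when-no (t ≟ z) t≢z _) (when-yes (¬? (t ≟ z)) t≢z _)

  self-share≤charge : ∀ z → self-share z ≤ charge z
  self-share≤charge z = subst (_≤ charge z) (trans (when-yes (z ⊑? z) ⊑-refl _) (share-self z)) (term≤∑ _ z)

  charge-covers-cost : ∀ z → cost z ≤ 4 * charge z
  charge-covers-cost z with heavy-or-light z
  ... | inj₁ h = subst (_≤ 4 * charge z) (sym (cost-heavy h))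
                   (*-monoʳ-≤ 4 (subst (_≤ charge z) (self-heavy h) (self-share≤charge z)))
    where
    self-heavy : heavy z ≡ true → self-share z ≡ 1
    self-heavy h rewrite h = refl
  ... | inj₂ l = light-case (W z ℕ.≟ 1)
    where
    light-case : Dec (W z ≡ 1) → cost z ≤ 4 * charge z
    light-case (yes W≡1) = subst (_≤ 4 * charge z) (sym (trans (cost-light l) (cong (λ w → 2 * 2 ^ level w) W≡1)))
                             (*-monoʳ-≤ 4 (subst (_≤ charge z) self-leaf (self-share≤charge z)))
      where
      self-leaf : self-share z ≡ 1
      self-leaf rewrite l = when-yes (W z ℕ.≟ 1) W≡1 1
    light-case (no W≢1) = begin
      cost z                       ≡⟨ cost-light l ⟩
      2 * 2 ^ level (W z)          ≤⟨ light-cost (W z) (≤∧≢⇒< (W-pos z) (W≢1 ∘ sym)) ⟩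
      4 * (W z ∸ 1)                ≡⟨ cong (λ w → 4 * (w ∸ 1)) (W-split z) ⟩
      4 * sum (proper z)           ≤⟨ *-monoʳ-≤ 4 (∑-mono pointwise) ⟩
      4 * charge z                 ∎
      where
      open ≤-Reasoning
      lightness≡1 : lightness z ≡ 1
      lightness≡1 rewrite l = refl
      pointwise : ∀ t → proper z t ≤ when (z ⊑? t) (share z t)
      pointwise t = when-mono (z ⊑? t) (≤-trans (≤-reflexive (cong (when (¬? (t ≟ z))) (sym lightness≡1))) (m≤n+m _ _))

  between : Fin m → Fin m → Fin m → ℕ
  between y v z = when (y ⊑? z) (when (¬? (z ≟ y)) (when (z ⊑? v) (lightness z)))

  light-between : Fin m → Fin m → ℕ
  light-between y v = sum (between y v)

  light-between-self : ∀ y → light-between y y ≡ 0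
  light-between-self y = ∑-zero (between y y) pointwise
    where
    pointwise : ∀ z → between y y z ≡ 0
    pointwise z with y ⊑? z | z ≟ y | z ⊑? y
    ... | yes y⊑z | no z≢y | yes z⊑y = contradiction (⊑-antisym z⊑y y⊑z) z≢y
    ... | yes _   | no _   | no  _   = refl
    ... | yes _   | yes _  | _       = refl
    ... | no  _   | _      | _       = refl

  light-between-step : ∀ {y v} → v ≢ y → v ≢ root → y ⊑ v → light-between y v ≡ lightness v + light-between y (par v)
  light-between-step {y} {v} v≢y v≢root y⊑v = begin
    sum (between y v)
      ≡⟨ sum-cong-≗ {m} {between y v} pointwise ⟩
    ∑[ z < m ] (when (z ≟ v) (lightness v) + between y (par v) z)
      ≡⟨ ∑-distrib-+ (λ z → when (z ≟ v) (lightness v)) _ ⟩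
    ∑[ z < m ] when (z ≟ v) (lightness v) + light-between y (par v)
      ≡⟨ cong (_+ light-between y (par v)) (∑-at v (λ _ → lightness v)) ⟩
    lightness v + light-between y (par v)
      ∎
    where
    open ≡-Reasoning
    pointwise : ∀ z → between y v z ≡ when (z ≟ v) (lightness v) + between y (par v) z
    pointwise z with z ≟ v
    ... | yes refl = begin
      between y z z                                    ≡⟨ when-yes (y ⊑? z) y⊑v _ ⟩
      when (¬? (z ≟ y)) (when (z ⊑? z) (lightness z))  ≡⟨ when-yes (¬? (z ≟ y)) v≢y _ ⟩
      when (z ⊑? z) (lightness z)                      ≡⟨ when-yes (z ⊑? z) ⊑-refl _ ⟩
      lightness z                                      ≡⟨ +-identityʳ _ ⟨
      lightness z + 0                                  ≡⟨ cong (lightness z +_) gone ⟨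
      lightness z + between y (par z) z                ∎
      where
      gone : between y (par z) z ≡ 0
      gone = trans (cong (λ i → when (y ⊑? z) (when (¬? (z ≟ y)) i)) (when-no (z ⊑? par z) (¬⊑par z v≢root) _))
                   (trans (cong (when (y ⊑? z)) (when-0 (¬? (z ≟ y)))) (when-0 (y ⊑? z)))
    ... | no z≢v = cong (λ i → when (y ⊑? z) (when (¬? (z ≟ y)) i))
                     (when-⇔ (z ⊑? v) (z ⊑? par v) (λ z⊑v → ⊏⇒⊑par v≢root z⊑v z≢v)
                                                   (λ z⊑pv → ⊑-trans z⊑pv (par-⊑ v)) _)

  potential-step : ∀ v → v ≢ root → (W v + 1) * 2 ^ lightness v ≤ W (par v) + 1
  potential-step v v≢root with heavy-or-light v
  ... | inj₁ h rewrite h = begin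
    (W v + 1) * 1   ≡⟨ *-identityʳ _ ⟩
    W v + 1         ≡⟨ +-comm (W v) 1 ⟩
    suc (W v)       ≤⟨ W-par v v≢root ⟩
    W (par v)       ≤⟨ m≤m+n _ 1 ⟩
    W (par v) + 1   ∎
    where open ≤-Reasoning
  ... | inj₂ l rewrite l = begin
    (W v + 1) * 2         ≡⟨ double (W v) ⟩
    suc (W v + W v) + 1   ≤⟨ +-monoˡ-≤ 1 (W-light v v≢root l) ⟩
    W (par v) + 1         ∎
    where
    open ≤-Reasoning
    open +-*-Solver
    double : ∀ w → (w + 1) * 2 ≡ suc (w + w) + 1
    double = solve 1 (λ w → (w :+ con 1) :* con 2 := (con 1 :+ (w :+ w)) :+ con 1) refl

  potential : ∀ {y} k v → iter par k v ≡ y → (W v + 1) * 2 ^ light-between y v ≤ W y + 1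
  potential {y} k v v↦y with v ≟ y
  ... | yes refl = ≤-reflexive (trans (cong (λ e → (W v + 1) * 2 ^ e) (light-between-self v)) (*-identityʳ _))
  potential zero    v v↦y | no v≢y = contradiction v↦y v≢y
  potential {y} (suc k) v v↦y | no v≢y = begin
    (W v + 1) * 2 ^ light-between y v
      ≡⟨ cong (λ e → (W v + 1) * 2 ^ e) (light-between-step v≢y v≢root (suc k , v↦y)) ⟩
    (W v + 1) * 2 ^ (lightness v + light-between y (par v))
      ≡⟨ cong ((W v + 1) *_) (^-distribˡ-+-* 2 (lightness v) _) ⟩
    (W v + 1) * (2 ^ lightness v * 2 ^ light-between y (par v))
      ≡⟨ *-assoc (W v + 1) _ _ ⟨
    (W v + 1) * 2 ^ lightness v * 2 ^ light-between y (par v)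
      ≤⟨ *-monoˡ-≤ _ (potential-step v v≢root) ⟩
    (W (par v) + 1) * 2 ^ light-between y (par v)
      ≤⟨ potential k (par v) (trans (sym (iter-suc k v)) v↦y) ⟩
    W y + 1
      ∎
    where
    open ≤-Reasoning
    v≢root : v ≢ root
    v≢root refl = v≢y (trans (sym (iter-root (suc k))) v↦y)

  -- κ y bounds the number of nodes charging any proper descendant of y
  κ : Fin m → ℕ
  κ y = 2 ⊔ level (W y)

  few-light-above : ∀ {y t} → y ⊑ t → t ≢ y → 2 + light-between y (par t) ≤ κ y
  few-light-above {y} {t} y⊑t t≢y = few-light-levels M (W y) (level (W y)) 3·2^M≤1+Wy (level-fits (W y))
    where
    open ≤-Reasoning
    t≢root : t ≢ root
    t≢root refl = t≢y (⊑-antisym (root-⊑ y) y⊑t)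
    y⊑pt = ⊏⇒⊑par t≢root y⊑t (t≢y ∘ sym)
    M = light-between y (par t)
    3·2^M≤1+Wy : 3 * 2 ^ M ≤ suc (W y)
    3·2^M≤1+Wy = begin
      3 * 2 ^ M                ≤⟨ *-monoˡ-≤ (2 ^ M) (+-monoˡ-≤ 1 (≤-trans (s≤s (W-pos t)) (W-par t t≢root))) ⟩
      (W (par t) + 1) * 2 ^ M  ≤⟨ potential (proj₁ y⊑pt) (par t) (proj₂ y⊑pt) ⟩
      W y + 1                  ≡⟨ +-comm (W y) 1 ⟩
      suc (W y)                ∎

  load : Fin m → Fin m → ℕ
  load y t = ∑[ z < m ] when (y ⊑? z) (when (z ⊑? t) (share z t))

  span≤4·load : ∀ y → span y ≤ 4 * ∑[ t < m ] load y t
  span≤4·load y = begin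
    ∑[ z < m ] when (y ⊑? z) (cost z)
      ≤⟨ ∑-mono (λ z → when-mono (y ⊑? z) (charge-covers-cost z)) ⟩
    ∑[ z < m ] when (y ⊑? z) (4 * charge z)
      ≡⟨ sum-cong-≗ {m} {λ z → when (y ⊑? z) (4 * charge z)} (λ z → when-* (y ⊑? z) 4 (charge z)) ⟩
    ∑[ z < m ] (4 * when (y ⊑? z) (charge z))
      ≡⟨ ∑-*ˡ 4 (λ z → when (y ⊑? z) (charge z)) ⟩
    4 * ∑[ z < m ] when (y ⊑? z) (charge z)
      ≡⟨ cong (4 *_) (sum-cong-≗ {m} {λ z → when (y ⊑? z) (charge z)} (λ z → when-∑ (y ⊑? z) (charged z))) ⟩
    4 * ∑[ z < m ] ∑[ t < m ] when (y ⊑? z) (charged z t)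
      ≡⟨ cong (4 *_) (∑-comm (λ z t → when (y ⊑? z) (charged z t))) ⟩
    4 * ∑[ t < m ] load y t
      ∎
    where
    open ≤-Reasoning
    charged : Fin m → Fin m → ℕ
    charged z t = when (z ⊑? t) (share z t)

  self-share≤1 : ∀ z → self-share z ≤ 1
  self-share≤1 z with heavy z
  ... | true  = ≤-refl
  ... | false = when-≤ (W z ℕ.≟ 1) 1

  lightness≤1 : ∀ z → lightness z ≤ 1
  lightness≤1 z with heavy z
  ... | true  = z≤n
  ... | false = ≤-refl

  load-outside : ∀ {y t} → ¬ y ⊑ t → load y t ≡ 0
  load-outside {y} {t} y⋢t = ∑-zero _ pointwise
    where
    pointwise : ∀ z → when (y ⊑? z) (when (z ⊑? t) (share z t)) ≡ 0
    pointwise z with y ⊑? z | z ⊑? t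
    ... | yes y⊑z | yes z⊑t = contradiction (⊑-trans y⊑z z⊑t) y⋢t
    ... | yes _   | no  _   = refl
    ... | no  _   | _       = refl

  load-self : ∀ y → load y y ≡ self-share y
  load-self y = trans (∑-single _ y vanish)
                      (trans (when-yes (y ⊑? y) ⊑-refl _) (trans (when-yes (y ⊑? y) ⊑-refl _) (share-self y)))
    where
    vanish : ∀ z → z ≢ y → when (y ⊑? z) (when (z ⊑? y) (share z y)) ≡ 0
    vanish z z≢y with y ⊑? z | z ⊑? y
    ... | yes y⊑z | yes z⊑y = contradiction (⊑-antisym z⊑y y⊑z) z≢y
    ... | yes _   | no  _   = refl
    ... | no  _   | _       = refl

  load-inside : ∀ {y t} → y ⊑ t → t ≢ y → load y t ≤ κ y
  load-inside {y} {t} y⊑t t≢y = begin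
    load y t
      ≤⟨ ∑-mono pointwise ⟩
    ∑[ z < m ] (at t z + (at y z + between y (par t) z))
      ≡⟨ ∑-distrib-+ (at t) _ ⟩
    sum (at t) + ∑[ z < m ] (at y z + between y (par t) z)
      ≡⟨ cong (sum (at t) +_) (∑-distrib-+ (at y) _) ⟩
    sum (at t) + (sum (at y) + light-between y (par t))
      ≡⟨ cong₂ (λ a b → a + (b + light-between y (par t))) (∑-at t (λ _ → 1)) (∑-at y (λ _ → 1)) ⟩
    2 + light-between y (par t)
      ≤⟨ few-light-above y⊑t t≢y ⟩
    κ y
      ∎
    where
    open ≤-Reasoning
    t≢root : t ≢ root
    t≢root refl = t≢y (⊑-antisym (root-⊑ y) y⊑t)
    pointwise : ∀ z → when (y ⊑? z) (when (z ⊑? t) (share z t)) ≤ at t z + (at y z + between y (par t) z)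
    pointwise z with z ≟ t
    ... | yes refl = ≤-trans (when-≤ (y ⊑? z) _) (≤-trans (when-≤ (z ⊑? z) _)
                       (≤-trans (≤-reflexive (share-self z)) (≤-trans (self-share≤1 z) (m≤m+n 1 _))))
    ... | no  z≢t with z ≟ y
    ...   | yes refl = ≤-trans (when-≤ (y ⊑? z) _) (≤-trans (when-≤ (z ⊑? t) _)
                         (≤-trans (≤-reflexive (share-other (z≢t ∘ sym))) (≤-trans (lightness≤1 z) (m≤m+n 1 _))))
    ...   | no  z≢y = when-mono (y ⊑? z) (≤-trans (when-mono (z ⊑? t) (≤-reflexive (share-other (z≢t ∘ sym))))
                        (when-imp (z ⊑? t) (z ⊑? par t) (λ z⊑t → ⊏⇒⊑par t≢root z⊑t z≢t) _))

  load≤ : ∀ y t → load y t ≤ when (t ≟ y) (self-share y) + κ y * proper y t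
  load≤ y t with y ⊑? t | t ≟ y
  ... | no  y⋢t | _      = ≤-trans (≤-reflexive (load-outside y⋢t)) z≤n
  ... | yes _   | yes refl = ≤-trans (≤-reflexive (load-self y)) (m≤m+n _ _)
  ... | yes y⊑t | no t≢y = ≤-trans (load-inside y⊑t t≢y) (≤-trans (≤-reflexive (sym (*-identityʳ (κ y)))) (m≤n+m _ _))

  span≤budget : ∀ y → heavy y ≡ false → span y ≤ budget (W y)
  span≤budget y y-light = begin
    span y
      ≤⟨ span≤4·load y ⟩
    4 * ∑[ t < m ] load y t
      ≤⟨ *-monoʳ-≤ 4 (∑-mono (load≤ y)) ⟩
    4 * ∑[ t < m ] (when (t ≟ y) (self-share y) + κ y * proper y t)
      ≡⟨ cong (4 *_) (∑-distrib-+ (λ t → when (t ≟ y) (self-share y)) _) ⟩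
    4 * (∑[ t < m ] when (t ≟ y) (self-share y) + ∑[ t < m ] (κ y * proper y t))
      ≡⟨ cong (4 *_) (cong₂ _+_ (∑-at y (λ _ → self-share y)) (∑-*ˡ (κ y) (proper y))) ⟩
    4 * (self-share y + κ y * sum (proper y))
      ≡⟨ cong (λ s → 4 * (s + κ y * sum (proper y))) self-share-light ⟩
    4 * (when (W y ℕ.≟ 1) 1 + κ y * sum (proper y))
      ≡⟨ cong (λ w → 4 * (when (W y ℕ.≟ 1) 1 + κ y * (w ∸ 1))) (W-split y) ⟨
    budget (W y)
      ∎
    where
    open ≤-Reasoning
    self-share-light : self-share y ≡ when (W y ℕ.≟ 1) 1
    self-share-light rewrite y-light = refl

  module Dimensions (n p : ℕ) (n≡2^p : n ≡ 2 ^ p) (1≤p : 1 ≤ p) (m≤n : m ≤ n) where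

    W≤2^p : ∀ x → W x ≤ 2 ^ p
    W≤2^p x = ≤-trans (W≤m x) (subst (m ≤_) n≡2^p m≤n)

    budget≤ : ∀ x → budget (W x) ≤ 4 * p * 2 ^ level (W x)
    budget≤ x = begin
      budget (W x)                         ≤⟨ budget-≤ (W x) ⟩
      4 * (level (W x) * 2 ^ level (W x))  ≤⟨ *-monoʳ-≤ 4 (*-monoˡ-≤ _ (level-≤ (W x) p (W≤2^p x) 1≤p)) ⟩
      4 * (p * 2 ^ level (W x))            ≡⟨ *-assoc 4 p _ ⟨
      4 * p * 2 ^ level (W x)              ∎
      where open ≤-Reasoning

    total≤ : total ≤ 4 * n * p
    total≤ = begin
      total                           ≡⟨ sum-cong-≗ {m} {cost} (λ x → sym (when-yes (root ⊑? x) (root-⊑ x) (cost x))) ⟩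
      span root                       ≤⟨ span≤budget root root-light ⟩
      budget (W root)                 ≤⟨ budget≤ root ⟩
      4 * p * 2 ^ level (W root)      ≤⟨ *-monoʳ-≤ (4 * p) (^-monoʳ-≤ 2 (level-≤ (W root) p (W≤2^p root) 1≤p)) ⟩
      4 * p * 2 ^ p                   ≡⟨ cong (4 * p *_) n≡2^p ⟨
      4 * p * n                       ≡⟨ *-assoc 4 p n ⟩
      4 * (p * n)                     ≡⟨ cong (4 *_) (*-comm p n) ⟩
      4 * (n * p)                     ≡⟨ *-assoc 4 n p ⟨
      4 * n * p                       ∎
      where open ≤-Reasoning

    right≤ : ∀ u → right u ≤ 4 * n * p
    right≤ u = ≤-trans (right≤pos+span u) (≤-trans (pos+span≤total u) total≤)

    lvl-range : ∀ u → 1 ≤ lvl u × lvl u ≤ p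
    lvl-range u with heavy-or-light u
    ... | inj₁ h = subst (1 ≤_) (sym (lvl-heavy h)) ≤-refl , subst (_≤ p) (sym (lvl-heavy h)) 1≤p
    ... | inj₂ l = subst (1 ≤_) (sym (lvl-light l)) (level-pos (W u)) ,
                   subst (_≤ p) (sym (lvl-light l)) (level-≤ (W u) p (W≤2^p u) 1≤p)

    len≤ : ∀ u → len u ≤ 4 * p
    len≤ u with heavy-or-light u
    ... | inj₁ h = subst (_≤ 4 * p) (sym (len-heavy h)) (≤-trans 1≤p (m≤m+n p _))
    ... | inj₂ l = <⇒≤ (*-cancelˡ-< (grid u) (len u) (4 * p) (begin-strict
      grid u * len u           <⟨ grid*len<span u l ⟩
      span u                   ≤⟨ span≤budget u l ⟩
      budget (W u)             ≤⟨ budget≤ u ⟩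
      4 * p * 2 ^ level (W u)  ≡⟨ cong (λ ℓ → 4 * p * 2 ^ ℓ) (lvl-light l) ⟨
      4 * p * grid u           ≡⟨ *-comm (4 * p) (grid u) ⟩
      grid u * (4 * p)         ∎))
      where open ≤-Reasoning

    in-range : ∀ u → In𝓘⊆ n p p (1 , 4 * n * p) (interval u)
    in-range u = (lvl u , lo u , len u , lvl-range u
                   , (s≤s z≤n , ≤-trans (≤-reflexive (*-comm (lo u) (grid u))) (≤-trans left≤right (right≤ u)))
                   , (len-pos u , len≤ u) , refl)
               , (≤-trans (s≤s z≤n) (pos<left u) , right≤ u)
      where
      left≤right : left u ≤ right u
      left≤right = subst (left u ≤_) (sym (right≡left+ u)) (m≤m+n _ _)

corollary1 : (n p : ℕ) → n ≡ 2 ^ p → 1 ≤ p →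
    (m : ℕ) → m ≤ n → (T : RootedTree m) →
    (heavy : Fin m → Bool) → HeavyChoice T heavy →
    (dfs : Fin m → Fin m) → IsDFS T heavy dfs →
    Σ (Fin m → Interval) λ I →
      (∀ u v → I u ≡ I v → u ≡ v)
      × (∀ u → In𝓘⊆ n p p (1 , 4 * n * p) (I u))
      × (∀ u → LPO1 T heavy dfs I u × LPO2 T heavy dfs I u)
corollary1 n p n≡2^p 1≤p m m≤n T heavy heavyChoice dfs isDFS =
  interval , interval-injective , in-range , λ u → lpo1 u , lpo2 u
  where
  open SizeBound T heavy heavyChoice dfs isDFS using (interval; interval-injective; module Dimensions)
  open Dimensions n p n≡2^p 1≤p m≤n using (in-range)
  open LocalOrder T heavy dfs isDFS using (lpo1; lpo2)
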